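{- Every $\omega BS$-regular language over the alphabet $\{a,b\}$ that contains a word with infinitely many occurrences of $b$ also contains a word of $(a^Bb+a^Sb)^\omega$, i.e., a word $a^{n_0}ba^{n_1}b\cdots$ for which $\mathbb N$ can be partitioned into sets $I,J$ such that $\{n_i:i\in I\}$ is bounded and, if $J$ is infinite, $n_j\to\infty$ as $j\to\infty$ in $J$.
   Context: A word sequence over $\Sigma$ is a finite or infinite sequence $\vec u=\langle u_0,u_1,\dots\rangle$ of finite words. An infinite sequence of naturals is bounded if $\limsup<\infty$, strongly unbounded if $\liminf=+\infty$. For non-decreasing $g$, $g'(i)=g(i+1)-g(i)$ for $i+1<|g|$; bounded (resp. strongly unbounded) difference means $g'$ finite or bounded (resp. finite or strongly unbounded). $K\cdot L=\{\langle u_0v_0,u_1v_1,\dots\rangle:\vec u\in K,\vec v\in L,|\vec u|=|\vec v|\}$; mix $K+L$ = set of $\vec w$ with $|\vec w|=\max(|\vec u|,|\vec v|)$ and $w_i\in\{u_i\}\cup\{v_i\}$ for $i<|\vec w|$, some $\vec u\in K,\vec v\in L$ ($\{u_i\}=\emptyset$ if $i\ge|\vec u|$); $L^*=\{\langle u_0\cdots u_{g(0)-1},u_{g(0)}\cdots u_{g(1)-1},\dots\rangle:\vec u\in L,g$ non-decreasing, values $\le|\vec u|\}$; $L^B,L^S$ likewise with $g$ of bounded, resp. strongly unbounded, difference. $BS$-regular expressions $e::=\emptyset\mid\varepsilon\mid\bar\varepsilon\mid a\mid e\cdot e\mid e+e\mid e^*\mid e^B\mid e^S$ with $[\![\emptyset]\!]=\{\langle\rangle\}$,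 $[\![\bar\varepsilon]\!]$ = finite sequences of empty words, $[\![\varepsilon]\!]=[\![\bar\varepsilon]\!]\cup\{\langle\varepsilon,\varepsilon,\dots\rangle\}$, $[\![a]\!]$ = all finite/infinite sequences of the word $a$. $\langle u_0,u_1,\dots\rangle^\omega=u_0u_1\cdots$ (defined if infinitely many $u_i$ nonempty). An $\omega BS$-regular expression $\sum_{i=1}^n e_i\cdot f_i^\omega$ ($e_i$ ordinary regular expressions, $f_i$ $BS$-regular) denotes $\bigcup_i[\![e_i]\!]\cdot[\![f_i]\!]^\omega$; $\omega BS$-regular languages are those so denoted. -}

module Defs where

open import Data.Nat using (ℕ; zero; suc; _+_; _∸_; _≤_; _<_; _⊔_)
open import Data.List using (List; []; _∷_; _++_; length; lookup; concat; map; upTo)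
open import Data.Fin using (Fin; toℕ)
open import Data.Product using (Σ; ∃; ∃-syntax; _×_; _,_)
open import Data.Sum using (_⊎_)
open import Data.Unit using (⊤)
open import Data.Empty using (⊥)
open import Relation.Nullary using (¬_)
open import Relation.Binary.PropositionalEquality using (_≡_)

data Len : Set where
  fin : ℕ → Len
  ∞   : Len

_<ᴸ_ : ℕ → Len → Set
i <ᴸ fin n = i < n
i <ᴸ ∞     = ⊤

_≤ᴸ_ : ℕ → Len → Set
i ≤ᴸ fin n = i ≤ n
i ≤ᴸ ∞     = ⊤

maxᴸ : Len → Len → Len
maxᴸ (fin m) (fin n) = fin (m ⊔ n)
maxᴸ (fin m) ∞       = ∞
maxᴸ ∞       _       = ∞

-- Word sequences: a length together with the entries.  Entries at
-- indices ≥ len are irrelevant; all semantic predicates below only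
-- inspect indices i with i <ᴸ len.

record WSeq (A : Set) : Set where
  constructor ⟨_,_⟩
  field
    len : Len
    at  : ℕ → List A
open WSeq public

block : {A : Set} → (ℕ → List A) → ℕ → ℕ → List A
block f a b = concat (map (λ k → f (a + k)) (upTo (b ∸ a)))

prevg : (ℕ → ℕ) → ℕ → ℕ
prevg g zero    = 0
prevg g (suc i) = g i

-- conditions on the grouping sequence g (of length l)
AnyDiff : Len → (ℕ → ℕ) → Set
AnyDiff _ _ = ⊤

BoundedDiff : Len → (ℕ → ℕ) → Set
BoundedDiff (fin _) g = ⊤
BoundedDiff ∞       g = ∃[ M ] (∀ i → g (suc i) ∸ g i ≤ M)

StronglyUnboundedDiff : Len → (ℕ → ℕ) → Set
StronglyUnboundedDiff (fin _) g = ⊤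
StronglyUnboundedDiff ∞       g =
  ∀ M → ∃[ N ] (∀ i → N ≤ i → M ≤ g (suc i) ∸ g i)

Star : {A : Set} → (Len → (ℕ → ℕ) → Set) → (WSeq A → Set) → WSeq A → Set
Star {A} P L w =
  Σ (WSeq A) λ u → L u ×
  Σ (ℕ → ℕ) λ g →
    P (len w) g
  × (∀ i → suc i <ᴸ len w → g i ≤ g (suc i))
  × (∀ i → i <ᴸ len w → g i ≤ᴸ len u)
  × (∀ i → i <ᴸ len w → at w i ≡ block (at u) (prevg g i) (g i))

data BSExpr (A : Set) : Set where
  ∅    : BSExpr A
  ε    : BSExpr A
  ε̄    : BSExpr A
  sym  : A → BSExpr A
  _⊙_  : BSExpr A → BSExpr A → BSExpr A
  _⊕_  : BSExpr A → BSExpr A → BSExpr A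
  _⋆   : BSExpr A → BSExpr A
  _ᴮ   : BSExpr A → BSExpr A
  _ˢ   : BSExpr A → BSExpr A

⟦_⟧ : {A : Set} → BSExpr A → WSeq A → Set
⟦ ∅ ⟧ w = len w ≡ fin 0
⟦ ε ⟧ w = ∀ i → i <ᴸ len w → at w i ≡ []
⟦ ε̄ ⟧ w = ∃[ n ] (len w ≡ fin n × (∀ i → i < n → at w i ≡ []))
⟦ sym a ⟧ w = ∀ i → i <ᴸ len w → at w i ≡ a ∷ []
⟦_⟧ {A} (e ⊙ f) w =
  Σ (WSeq A) λ u → Σ (WSeq A) λ v →
    ⟦ e ⟧ u × ⟦ f ⟧ v × len u ≡ len v × len w ≡ len u
  × (∀ i → i <ᴸ len w → at w i ≡ at u i ++ at v i)
⟦_⟧ {A} (e ⊕ f) w =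
  Σ (WSeq A) λ u → Σ (WSeq A) λ v →
    ⟦ e ⟧ u × ⟦ f ⟧ v × len w ≡ maxᴸ (len u) (len v)
  × (∀ i → i <ᴸ len w →
       (i <ᴸ len u × at w i ≡ at u i) ⊎ (i <ᴸ len v × at w i ≡ at v i))
⟦ e ⋆ ⟧ = Star AnyDiff ⟦ e ⟧
⟦ e ᴮ ⟧ = Star BoundedDiff ⟦ e ⟧
⟦ e ˢ ⟧ = Star StronglyUnboundedDiff ⟦ e ⟧

pos : {A : Set} → (ℕ → List A) → ℕ → ℕ
pos f zero    = 0
pos f (suc i) = pos f i + length (f i)

IsOmega : {A : Set} → WSeq A → (ℕ → A) → Set
IsOmega u x =
    len u ≡ ∞
  × (∀ N → ∃[ i ] (N ≤ i × ¬ (at u i ≡ [])))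
  × (∀ i (k : Fin (length (at u i))) →
       x (pos (at u) i + toℕ k) ≡ lookup (at u i) k)

OmegaPow : {A : Set} → (WSeq A → Set) → (ℕ → A) → Set
OmegaPow {A} L x = Σ (WSeq A) λ u → L u × IsOmega u x

data RE (A : Set) : Set where
  ∅ʳ   : RE A
  εʳ   : RE A
  symʳ : A → RE A
  _·ʳ_ : RE A → RE A → RE A
  _+ʳ_ : RE A → RE A → RE A
  _*ʳ  : RE A → RE A

data StarW {A : Set} (P : List A → Set) : List A → Set where
  nil  : StarW P []
  cons : ∀ {u v} → P u → StarW P v → StarW P (u ++ v)

REsem : {A : Set} → RE A → List A → Set
REsem ∅ʳ w = ⊥
REsem εʳ w = w ≡ []
REsem (symʳ a) w = w ≡ a ∷ []
REsem (e ·ʳ f) w = ∃[ u ] ∃[ v ] (REsem e u × REsem f v × w ≡ u ++ v)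
REsem (e +ʳ f) w = REsem e w ⊎ REsem f w
REsem (e *ʳ) w = StarW (REsem e) w

-- ωBS-regular expressions  Σ_i e_i · f_i^ω  and ωBS-regular languages

ωBSExpr : Set → Set
ωBSExpr A = List (RE A × BSExpr A)

ProdSem : {A : Set} → RE A → BSExpr A → (ℕ → A) → Set
ProdSem {A} e f x =
  Σ (List A) λ w → REsem e w ×
  Σ (ℕ → A) λ y → OmegaPow ⟦ f ⟧ y
  × (∀ (k : Fin (length w)) → x (toℕ k) ≡ lookup w k)
  × (∀ k → x (length w + k) ≡ y k)

⟦_⟧ω : {A : Set} → ωBSExpr A → (ℕ → A) → Set
⟦ [] ⟧ω x = ⊥
⟦ (e , f) ∷ r ⟧ω x = ProdSem e f x ⊎ ⟦ r ⟧ω x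

IsωBSRegular : {A : Set} → ((ℕ → A) → Set) → Set
IsωBSRegular {A} L =
  Σ (ωBSExpr A) λ E → ∀ x → (L x → ⟦ E ⟧ω x) × (⟦ E ⟧ω x → L x)

data AB : Set where
  a b : AB

InfinitelyManyB : (ℕ → AB) → Set
InfinitelyManyB x = ∀ N → ∃[ k ] (N ≤ k × x k ≡ b)

target : ωBSExpr AB
target = (εʳ , ((((sym a) ᴮ) ⊙ sym b) ⊕ (((sym a) ˢ) ⊙ sym b))) ∷ []

-- Every BS-language L is of one of three kinds: all members of L are finite; or L has an infinite
-- member all of whose entries consist of a's only, while (classically) every member of L has only
-- finitely many entries containing b; or L has an infinite member c every entry of which contains
-- a b and whose runs of a's are tame: for some K and every m, from entry m on, each run of a's
-- ending in a b is at most K or at least m. The operations of BS-expressions preserve this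
-- trichotomy; for an S-iteration c is regrouped into blocks of i + 1 entries, and the bound only
-- doubles because every entry contains a b, which resets the run. If w·u^ω ∈ L with u ∈ [[f]] has
-- infinitely many b's, then [[f]] is of the third kind, so y = w·c^ω ∈ L as well, and the runs
-- n₀, n₁, … of a's before the successive b's of y are eventually at most 2K or at least m, for
-- every m. Sending the n_k ≤ 2K to a^B b and the others to a^S b exhibits y in (a^B b + a^S b)^ω.

module Submission where

open import Defs
open import Data.Nat
  using (ℕ; zero; suc; _+_; _*_; _∸_; _≤_; _<_; _≤′_; ≤′-refl; ≤′-step; _⊔_; z≤n; s≤s)
open import Data.Nat.Properties
open import Data.List
  using (List; []; _∷_; _++_; [_]; length; lookup; replicate; concat; applyUpTo; foldl)
open import Data.List.Properties
  using (length-++; length-replicate; foldl-++; concat-++; map-upTo; applyUpTo-∷ʳ; ++-identityʳ)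
open import Data.List.Membership.Propositional using (_∈_)
open import Data.List.Membership.Propositional.Properties using (∈-++⁺ˡ; ∈-++⁺ʳ; ∈-lookup)
open import Data.List.Relation.Unary.All using (All; []; _∷_)
open import Data.List.Relation.Unary.All.Properties using (++⁺)
open import Data.List.Relation.Unary.Any using (here; there; index)
open import Data.List.Relation.Unary.Any.Properties using (lookup-index)
open import Data.Fin as Fin using (Fin; toℕ; fromℕ<)
open import Data.Fin.Properties using (toℕ<n; toℕ-fromℕ<; toℕ-injective)
open import Data.Product using (Σ; ∃-syntax; _×_; _,_; proj₁; proj₂)
open import Data.Sum using (_⊎_; inj₁; inj₂)
open import Data.Unit using (⊤; tt)
open import Data.Empty using (⊥-elim)
open import Function using (_∘_; case_of_)
open import Level using (0ℓ)
open import Effect.Monad using (RawMonad)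
open import Relation.Nullary using (¬_; yes; no)
open import Relation.Nullary.Decidable using (¬¬-excluded-middle)
open import Relation.Nullary.Negation using (¬¬-Monad)
open import Relation.Binary.PropositionalEquality
  using (_≡_; refl; trans; subst; cong; cong₂; module ≡-Reasoning) renaming (sym to ≡-sym)

open RawMonad (¬¬-Monad {0ℓ}) using (pure; _>>=_)

NonDecreasing : (ℕ → ℕ) → Set
NonDecreasing g = ∀ i → g i ≤ g (suc i)

NonDecreasing-≤ : ∀ {g} → NonDecreasing g → ∀ {i j} → i ≤ j → g i ≤ g j
NonDecreasing-≤ {g} mono i≤j = go (≤⇒≤′ i≤j)
  where
  go : ∀ {i j} → i ≤′ j → g i ≤ g j
  go ≤′-refl        = ≤-refl
  go (≤′-step i≤′j) = ≤-trans (go i≤′j) (mono _)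

EventuallyConstant : (ℕ → ℕ) → Set
EventuallyConstant g = Σ ℕ λ N → ∀ i → N ≤ i → g i ≡ g N

-- induction on the room D left above g 0: every increase of g uses some of it up
NonDecreasing-bounded⇒EventuallyConstant :
  ∀ D g → NonDecreasing g → (∀ i → g i ≤ D + g 0) → ¬ ¬ EventuallyConstant g
NonDecreasing-bounded⇒EventuallyConstant D g mono bnd = ¬¬-excluded-middle >>= λ where
    (no never-above)    → pure (0 , λ i _ → ≤-antisym (≮⇒≥ (λ g0<gi → never-above (i , g0<gi)))
                                                       (NonDecreasing-≤ mono z≤n))
    (yes (i₁ , g0<gi₁)) → from D i₁ g0<gi₁ bnd
  where
  from : ∀ D i₁ → g 0 < g i₁ → (∀ i → g i ≤ D + g 0) → ¬ ¬ EventuallyConstant g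
  from zero    i₁ g0<gi₁ bnd = ⊥-elim (≤⇒≯ (bnd i₁) g0<gi₁)
  from (suc D) i₁ g0<gi₁ bnd =
    NonDecreasing-bounded⇒EventuallyConstant D (λ j → g (j + i₁)) (λ j → mono (j + i₁))
      (λ j → ≤-trans (bnd (j + i₁))
                     (≤-trans (≤-reflexive (≡-sym (+-suc D (g 0)))) (+-monoʳ-≤ D g0<gi₁)))
    >>= λ (N , const) → pure (N + i₁ , λ i N+i₁≤i →
      trans (cong g (≡-sym (m∸n+n≡m (≤-trans (m≤n+m i₁ N) N+i₁≤i))))
            (const (i ∸ i₁) (m+n≤o⇒m≤o∸n N N+i₁≤i)))

concatUpTo : {A : Set} → (ℕ → List A) → ℕ → List A
concatUpTo h zero    = []
concatUpTo h (suc n) = concatUpTo h n ++ h n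

concat-applyUpTo : {A : Set} (h : ℕ → List A) (n : ℕ) →
                   concat (applyUpTo h n) ≡ concatUpTo h n
concat-applyUpTo h zero = refl
concat-applyUpTo h (suc n) = begin
  concat (applyUpTo h (suc n))
    ≡⟨ cong concat (≡-sym (applyUpTo-∷ʳ h n)) ⟩
  concat (applyUpTo h n ++ [ h n ])
    ≡⟨ ≡-sym (concat-++ (applyUpTo h n) [ h n ]) ⟩
  concat (applyUpTo h n) ++ (h n ++ [])
    ≡⟨ cong₂ _++_ (concat-applyUpTo h n) (++-identityʳ (h n)) ⟩
  concatUpTo h n ++ h n
    ∎
  where open ≡-Reasoning

block-concatUpTo : {A : Set} (f : ℕ → List A) (p q : ℕ) →
                   block f p q ≡ concatUpTo (λ k → f (p + k)) (q ∸ p)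
block-concatUpTo f p q = trans (cong concat (map-upTo _ (q ∸ p))) (concat-applyUpTo _ (q ∸ p))

block-suc : {A : Set} (f : ℕ → List A) (i : ℕ) → block f i (suc i) ≡ f i
block-suc f i = begin
  block f i (suc i)                        ≡⟨ block-concatUpTo f i (suc i) ⟩
  concatUpTo (λ k → f (i + k)) (suc i ∸ i) ≡⟨ cong (concatUpTo _) (m+n∸n≡m 1 i) ⟩
  f (i + 0)                                ≡⟨ cong f (+-identityʳ i) ⟩
  f i                                      ∎
  where open ≡-Reasoning

concatUpTo-All : ∀ {A : Set} {P : A → Set} (h : ℕ → List A) n →
                 (∀ k → k < n → All P (h k)) → All P (concatUpTo h n)
concatUpTo-All h zero    _   = []
concatUpTo-All h (suc n) all =
  ++⁺ (concatUpTo-All h n (λ k k<n → all k (m<n⇒m<1+n k<n))) (all n ≤-refl)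

m<o∸n⇒n+m<o : ∀ m n o → m < o ∸ n → n + m < o
m<o∸n⇒n+m<o m zero    o       m<o   = m<o
m<o∸n⇒n+m<o m (suc n) (suc o) m<o∸n = s≤s (m<o∸n⇒n+m<o m n o m<o∸n)

block-All : ∀ {A : Set} {P : A → Set} (f : ℕ → List A) p q →
            (∀ k → p ≤ k → k < q → All P (f k)) → All P (block f p q)
block-All f p q all = subst (All _) (≡-sym (block-concatUpTo f p q))
  (concatUpTo-All _ (q ∸ p) (λ k k<q∸p → all (p + k) (m≤m+n p k) (m<o∸n⇒n+m<o k p q k<q∸p)))

length-concatUpTo : ∀ {A : Set} (h : ℕ → List A) n {l} → (∀ k → length (h k) ≡ l) →
                    length (concatUpTo h n) ≡ n * l
length-concatUpTo h zero    _  = refl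
length-concatUpTo h (suc n) {l} hl = begin
  length (concatUpTo h n ++ h n)         ≡⟨ length-++ (concatUpTo h n) ⟩
  length (concatUpTo h n) + length (h n) ≡⟨ cong₂ _+_ (length-concatUpTo h n hl) (hl n) ⟩
  n * l + l                              ≡⟨ +-comm (n * l) l ⟩
  suc n * l                              ∎
  where open ≡-Reasoning

length-last≤length-concatUpTo : ∀ {A : Set} (h : ℕ → List A) n →
                                length (h n) ≤ length (concatUpTo h (suc n))
length-last≤length-concatUpTo h n =
  ≤-trans (m≤n+m _ (length (concatUpTo h n)))
          (≤-reflexive (≡-sym (length-++ (concatUpTo h n))))

concatUpTo-singleton : ∀ {A : Set} (x : A) n → concatUpTo (λ _ → [ x ]) n ≡ replicate n x
concatUpTo-singleton x zero    = refl
concatUpTo-singleton x (suc n) = trans (cong (_++ [ x ]) (concatUpTo-singleton x n)) (snoc n)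
  where
  snoc : ∀ n → replicate n x ++ [ x ] ≡ x ∷ replicate n x
  snoc zero    = refl
  snoc (suc n) = cong (x ∷_) (snoc n)

block-singleton : ∀ {A : Set} (x : A) p q → block (λ _ → [ x ]) p q ≡ replicate (q ∸ p) x
block-singleton x p q =
  trans (block-concatUpTo (λ _ → [ x ]) p q) (concatUpTo-singleton x (q ∸ p))

Seq : Set
Seq = ℕ → List AB

AOnly : List AB → Set
AOnly = All (_≡ a)

AOnly⇒b∉ : ∀ {s} → AOnly s → ¬ (b ∈ s)
AOnly⇒b∉ (() ∷ _)  (here refl)
AOnly⇒b∉ (_  ∷ as) (there b∈s) = AOnly⇒b∉ as b∈s

step : ℕ → AB → ℕ
step r a = suc r
step r b = 0

aRun : ℕ → List AB → ℕ
aRun = foldl step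

aRun-reset : ∀ {s} r r' → b ∈ s → aRun r s ≡ aRun r' s
aRun-reset r r' (here refl) = refl
aRun-reset {x ∷ _} r r' (there p) = aRun-reset (step r x) (step r' x) p

aRun-AOnly : ∀ {s} r → AOnly s → aRun r s ≡ r + length s
aRun-AOnly r [] = ≡-sym (+-identityʳ r)
aRun-AOnly r (refl ∷ p) = trans (aRun-AOnly (suc r) p) (≡-sym (+-suc r _))

SmallOrLarge : ℕ → ℕ → ℕ → Set
SmallOrLarge C m n = n ≤ C ⊎ m ≤ n

SmallOrLarge-mono : ∀ {C C' m n} → C ≤ C' → SmallOrLarge C m n → SmallOrLarge C' m n
SmallOrLarge-mono C≤C' (inj₁ n≤C) = inj₁ (≤-trans n≤C C≤C')
SmallOrLarge-mono C≤C' (inj₂ m≤n) = inj₂ m≤n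

SmallOrLarge-+ : ∀ {C D m n p} → SmallOrLarge C m n → SmallOrLarge D m p →
                 SmallOrLarge (C + D) m (n + p)
SmallOrLarge-+ (inj₁ n≤C) (inj₁ p≤D) = inj₁ (+-mono-≤ n≤C p≤D)
SmallOrLarge-+ {n = n} {p} (inj₂ m≤n) _ = inj₂ (≤-trans m≤n (m≤m+n n p))
SmallOrLarge-+ {n = n} {p} (inj₁ _) (inj₂ m≤p) = inj₂ (≤-trans m≤p (m≤n+m p n))

Tame : ℕ → ℕ → ℕ → List AB → Set
Tame C m r []      = ⊤
Tame C m r (x ∷ s) = (x ≡ b → SmallOrLarge C m r) × Tame C m (step r x) s

Tame-mono : ∀ {C C' m} r s → C ≤ C' → Tame C m r s → Tame C' m r s
Tame-mono r [] _ _ = tt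
Tame-mono r (x ∷ s) C≤C' (atB , rest) =
  (λ x≡b → SmallOrLarge-mono C≤C' (atB x≡b)) , Tame-mono (step r x) s C≤C' rest

Tame-++ : ∀ {C m} r s {t} → Tame C m r s → Tame C m (aRun r s) t → Tame C m r (s ++ t)
Tame-++ r [] _ tame-t = tame-t
Tame-++ r (x ∷ s) (atB , tame-s) tame-t = atB , Tame-++ (step r x) s tame-s tame-t

Tame-AOnly : ∀ {C m s} r → AOnly s → Tame C m r s
Tame-AOnly r [] = tt
Tame-AOnly r (refl ∷ p) = (λ ()) , Tame-AOnly (suc r) p

TameWord : ℕ → ℕ → List AB → Set
TameWord K m s = ∀ {C r} → SmallOrLarge C m r →
                 Tame (C + K) m r s × SmallOrLarge (C + K) m (aRun r s)

TameWord-++ : ∀ {K L m} s t → TameWord K m s → TameWord L m t → TameWord (K + L) m (s ++ t)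
TameWord-++ {K} {L} {m} s t tame-s tame-t {C} {r} r-ok with tame-s r-ok
... | Ts , s-ok with tame-t s-ok
... | Tt , t-ok =
  subst (λ D → Tame D m r (s ++ t) × SmallOrLarge D m (aRun r (s ++ t))) (+-assoc C K L)
    ( Tame-++ r s (Tame-mono r s (m≤m+n (C + K) L) Ts) Tt
    , subst (SmallOrLarge (C + K + L) m) (≡-sym (foldl-++ step r s t)) t-ok)

TameWord-AOnly : ∀ {K m s} → AOnly s → SmallOrLarge K m (length s) → TameWord K m s
TameWord-AOnly {K} {m} aOnly len-ok {C} {r} r-ok =
  Tame-AOnly r aOnly ,
  subst (SmallOrLarge (C + K) m) (≡-sym (aRun-AOnly r aOnly)) (SmallOrLarge-+ r-ok len-ok)

TameWord-reset : ∀ {K m s} → b ∈ s → TameWord K m s → ∀ r → SmallOrLarge K m (aRun r s)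
TameWord-reset {K} {m} b∈s tame r =
  subst (SmallOrLarge K m) (aRun-reset 0 r b∈s) (proj₂ (tame {0} {0} (inj₁ z≤n)))

-- every entry contains a b, which resets the run, so the bound does not grow with n
concatUpTo-TameWord : ∀ {K m} h → (∀ k → b ∈ h k) → (∀ k → TameWord K m (h k)) →
                      ∀ n → TameWord (K + K) m (concatUpTo h n)
concatUpTo-TameWord {K} {m} h hasB tame n {C} {r} r-ok =
  subst (λ D → Tame D m r (concatUpTo h n)) (+-assoc C K K) (proj₁ (prefixes n)) ,
  SmallOrLarge-mono (+-monoʳ-≤ C (m≤m+n K K)) (proj₂ (prefixes n))
  where
  prefixes : ∀ n → Tame (C + K + K) m r (concatUpTo h n) ×
                   SmallOrLarge (C + K) m (aRun r (concatUpTo h n))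
  prefixes zero = tt , SmallOrLarge-mono (m≤m+n C K) r-ok
  prefixes (suc n) with prefixes n
  ... | Tpre , pre-ok =
    Tame-++ r (concatUpTo h n) Tpre (proj₁ (tame n pre-ok)) ,
    subst (SmallOrLarge (C + K) m) (≡-sym (foldl-++ step r (concatUpTo h n) (h n)))
          (SmallOrLarge-mono (m≤n+m K C) (TameWord-reset (hasB n) (tame n) _))

TameSeq : ℕ → Seq → Set
TameSeq K c = ∀ {m} i → m ≤ i → TameWord K m (c i)

emptySeq : {A : Set} → WSeq A
emptySeq = ⟨ fin 0 , (λ _ → []) ⟩

emptySeq∈ : {A : Set} (f : BSExpr A) → ⟦ f ⟧ emptySeq
emptySeq∈Star : {A : Set} (P : Len → (ℕ → ℕ) → Set) (e : BSExpr A) →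
                P (fin 0) (λ _ → 0) → Star P ⟦ e ⟧ emptySeq
emptySeq∈Star P e p = emptySeq , emptySeq∈ e , (λ _ → 0) , p , (λ _ ()) , (λ _ ()) , (λ _ ())

emptySeq∈ ∅       = refl
emptySeq∈ ε       = λ _ ()
emptySeq∈ ε̄       = 0 , refl , λ _ ()
emptySeq∈ (sym x) = λ _ ()
emptySeq∈ (e ⊙ f) = emptySeq , emptySeq , emptySeq∈ e , emptySeq∈ f , refl , refl , λ _ ()
emptySeq∈ (e ⊕ f) = emptySeq , emptySeq , emptySeq∈ e , emptySeq∈ f , refl , λ _ ()
emptySeq∈ (e ⋆)   = emptySeq∈Star AnyDiff e tt
emptySeq∈ (e ᴮ)   = emptySeq∈Star BoundedDiff e tt
emptySeq∈ (e ˢ)   = emptySeq∈Star StronglyUnboundedDiff e tt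

⊙-∞ : ∀ (e f : BSExpr AB) {c d} → ⟦ e ⟧ ⟨ ∞ , c ⟩ → ⟦ f ⟧ ⟨ ∞ , d ⟩ →
      ⟦ e ⊙ f ⟧ ⟨ ∞ , (λ i → c i ++ d i) ⟩
⊙-∞ e f {c} {d} ec fd = ⟨ ∞ , c ⟩ , ⟨ ∞ , d ⟩ , ec , fd , refl , refl , λ _ _ → refl

⊕-∞ˡ : ∀ (e f : BSExpr AB) {c} → ⟦ e ⟧ ⟨ ∞ , c ⟩ → ⟦ e ⊕ f ⟧ ⟨ ∞ , c ⟩
⊕-∞ˡ e f {c} ec = ⟨ ∞ , c ⟩ , emptySeq , ec , emptySeq∈ f , refl , λ _ _ → inj₁ (tt , refl)

⊕-∞ʳ : ∀ (e f : BSExpr AB) {c} → ⟦ f ⟧ ⟨ ∞ , c ⟩ → ⟦ e ⊕ f ⟧ ⟨ ∞ , c ⟩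
⊕-∞ʳ e f {c} fc = emptySeq , ⟨ ∞ , c ⟩ , emptySeq∈ e , fc , refl , λ _ _ → inj₂ (tt , refl)

Star-identity : ∀ {P : Len → (ℕ → ℕ) → Set} {L : WSeq AB → Set} {c} →
                P ∞ suc → L ⟨ ∞ , c ⟩ → Star P L ⟨ ∞ , c ⟩
Star-identity {c = c} p Lc =
  ⟨ ∞ , c ⟩ , Lc , suc , p , (λ i _ → n≤1+n (suc i)) , (λ _ _ → tt) , entries
  where
  entries : ∀ i → ⊤ → c i ≡ block c (prevg suc i) (suc i)
  entries zero    _ = ≡-sym (block-suc c 0)
  entries (suc i) _ = ≡-sym (block-suc c (suc i))

Star-emptyEntries : ∀ {P : Len → (ℕ → ℕ) → Set} {L : WSeq AB → Set} →
                    P ∞ (λ _ → 0) → L emptySeq → Star P L ⟨ ∞ , (λ _ → []) ⟩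
Star-emptyEntries p L∅ =
  emptySeq , L∅ , (λ _ → 0) , p , (λ _ _ → z≤n) , (λ _ _ → z≤n) ,
  λ { zero _ → refl ; (suc _) _ → refl }

tri : ℕ → ℕ
tri zero    = 0
tri (suc n) = tri n + suc n

n≤tri : ∀ n → n ≤ tri n
n≤tri zero    = z≤n
n≤tri (suc n) = m≤n+m (suc n) (tri n)

-- entry i groups the i + 1 entries with indices tri i, …, tri i + i
triBlocks : Seq → Seq
triBlocks c i = block c (prevg (tri ∘ suc) i) (tri (suc i))

triBlocks-concatUpTo : ∀ c i → triBlocks c i ≡ concatUpTo (λ k → c (tri i + k)) (suc i)
triBlocks-concatUpTo c zero    = block-concatUpTo c 0 1
triBlocks-concatUpTo c (suc i) =
  trans (block-concatUpTo c (tri (suc i)) (tri (suc (suc i))))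
        (cong (concatUpTo _) (m+n∸m≡n (tri (suc i)) (suc (suc i))))

Star-triangular : ∀ {L : WSeq AB → Set} {c} → L ⟨ ∞ , c ⟩ →
                  Star StronglyUnboundedDiff L ⟨ ∞ , triBlocks c ⟩
Star-triangular {c = c} Lc =
  ⟨ ∞ , c ⟩ , Lc , tri ∘ suc , unbounded , (λ i _ → m≤m+n (tri (suc i)) (suc (suc i))) ,
  (λ _ _ → tt) , (λ _ _ → refl)
  where
  unbounded : StronglyUnboundedDiff ∞ (tri ∘ suc)
  unbounded M = M , λ i M≤i →
    ≤-trans (m≤n⇒m≤1+n (m≤n⇒m≤1+n M≤i))
            (≤-reflexive (≡-sym (m+n∸m≡n (tri (suc i)) (suc (suc i)))))

-- A trichotomy for BS-languages

-- unlike bounded-or-large lengths, this survives the triangular grouping of an S-iteration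
data StableOrGrowing (c : Seq) : Set where
  stable  : ∀ l → (∀ i → length (c i) ≡ l) → StableOrGrowing c
  growing : (∀ i → i ≤ length (c i)) → StableOrGrowing c

record TameMember (L : WSeq AB → Set) : Set where
  field
    seq    : Seq
    member : L ⟨ ∞ , seq ⟩
    bound  : ℕ
    tame   : TameSeq bound seq

record BMember (L : WSeq AB → Set) : Set where
  field
    tameMember : TameMember L
  open TameMember tameMember public
  field
    hasB : ∀ i → b ∈ seq i

record AMember (L : WSeq AB → Set) : Set where
  field
    seq     : Seq
    member  : L ⟨ ∞ , seq ⟩
    aOnly   : ∀ i → AOnly (seq i)
    lengths : StableOrGrowing seq

StableOrGrowing-SmallOrLarge : ∀ {c} → StableOrGrowing c →
  Σ ℕ λ k → ∀ {m} i → m ≤ i → SmallOrLarge k m (length (c i))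
StableOrGrowing-SmallOrLarge (stable l len≡l) = l , λ i _ → inj₁ (≤-reflexive (len≡l i))
StableOrGrowing-SmallOrLarge (growing i≤len)  = 0 , λ i m≤i → inj₂ (≤-trans m≤i (i≤len i))

AMember⇒TameMember : ∀ {L} → AMember L → TameMember L
AMember⇒TameMember x with StableOrGrowing-SmallOrLarge (AMember.lengths x)
... | k , lengths-ok = record
  { seq    = seq
  ; member = member
  ; bound  = k
  ; tame   = λ i m≤i → TameWord-AOnly (aOnly i) (lengths-ok i m≤i)
  }
  where open AMember x

TameMember-map : ∀ {L M : WSeq AB → Set} → (∀ {c} → L ⟨ ∞ , c ⟩ → M ⟨ ∞ , c ⟩) →
                 TameMember L → TameMember M
TameMember-map L⇒M x = record { TameMember x ; member = L⇒M (TameMember.member x) }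

BMember-map : ∀ {L M : WSeq AB → Set} → (∀ {c} → L ⟨ ∞ , c ⟩ → M ⟨ ∞ , c ⟩) →
              BMember L → BMember M
BMember-map L⇒M x = record
  { tameMember = TameMember-map L⇒M (BMember.tameMember x) ; hasB = BMember.hasB x }

AMember-map : ∀ {L M : WSeq AB → Set} → (∀ {c} → L ⟨ ∞ , c ⟩ → M ⟨ ∞ , c ⟩) →
              AMember L → AMember M
AMember-map L⇒M x = record { AMember x ; member = L⇒M (AMember.member x) }

TameMember-⊙ : ∀ {e f} → TameMember ⟦ e ⟧ → TameMember ⟦ f ⟧ → TameMember ⟦ e ⊙ f ⟧
TameMember-⊙ {e} {f} x y = record
  { seq    = λ i → X.seq i ++ Y.seq i
  ; member = ⊙-∞ e f X.member Y.member
  ; bound  = X.bound + Y.bound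
  ; tame   = λ i m≤i → TameWord-++ (X.seq i) (Y.seq i) (X.tame i m≤i) (Y.tame i m≤i)
  }
  where module X = TameMember x
        module Y = TameMember y

BMember-⊙ˡ : ∀ {e f} → BMember ⟦ e ⟧ → TameMember ⟦ f ⟧ → BMember ⟦ e ⊙ f ⟧
BMember-⊙ˡ {e} {f} x y = record
  { tameMember = TameMember-⊙ {e} {f} (BMember.tameMember x) y
  ; hasB       = λ i → ∈-++⁺ˡ (BMember.hasB x i)
  }

BMember-⊙ʳ : ∀ {e f} → TameMember ⟦ e ⟧ → BMember ⟦ f ⟧ → BMember ⟦ e ⊙ f ⟧
BMember-⊙ʳ {e} {f} x y = record
  { tameMember = TameMember-⊙ {e} {f} x (BMember.tameMember y)
  ; hasB       = λ i → ∈-++⁺ʳ (TameMember.seq x i) (BMember.hasB y i)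
  }

AMember-⊙ : ∀ {e f} → AMember ⟦ e ⟧ → AMember ⟦ f ⟧ → AMember ⟦ e ⊙ f ⟧
AMember-⊙ {e} {f} x y = record
  { seq     = λ i → X.seq i ++ Y.seq i
  ; member  = ⊙-∞ e f X.member Y.member
  ; aOnly   = λ i → ++⁺ (X.aOnly i) (Y.aOnly i)
  ; lengths = lengths X.lengths Y.lengths
  }
  where
  module X = AMember x
  module Y = AMember y
  length-++≥ : ∀ {n} i → n ≤ length (X.seq i) + length (Y.seq i) → n ≤ length (X.seq i ++ Y.seq i)
  length-++≥ i n≤ = ≤-trans n≤ (≤-reflexive (≡-sym (length-++ (X.seq i))))
  lengths : StableOrGrowing X.seq → StableOrGrowing Y.seq →
            StableOrGrowing (λ i → X.seq i ++ Y.seq i)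
  lengths (stable k lx) (stable l ly) =
    stable (k + l) λ i → trans (length-++ (X.seq i)) (cong₂ _+_ (lx i) (ly i))
  lengths (growing gx)  _             = growing λ i → length-++≥ i (≤-trans (gx i) (m≤m+n _ _))
  lengths (stable _ _)  (growing gy)  = growing λ i → length-++≥ i (≤-trans (gy i) (m≤n+m _ _))

BMember-triangular : ∀ {L} → BMember L → BMember (Star StronglyUnboundedDiff L)
BMember-triangular x = record
  { tameMember = record
    { seq    = triBlocks seq
    ; member = Star-triangular member
    ; bound  = bound + bound
    ; tame   = λ i m≤i → subst (TameWord _ _) (≡-sym (triBlocks-concatUpTo seq i))
        (concatUpTo-TameWord _ (λ k → hasB (tri i + k))
          (λ k → tame (tri i + k) (≤-trans m≤i (≤-trans (n≤tri i) (m≤m+n _ k)))) (suc i))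
    }
  ; hasB = λ i → subst (b ∈_) (≡-sym (triBlocks-concatUpTo seq i))
                   (∈-++⁺ʳ (concatUpTo _ i) (hasB (tri i + i)))
  }
  where open BMember x

AMember-triangular : ∀ {L} → AMember L → AMember (Star StronglyUnboundedDiff L)
AMember-triangular x = record
  { seq     = triBlocks seq
  ; member  = Star-triangular member
  ; aOnly   = λ i → subst AOnly (≡-sym (triBlocks-concatUpTo seq i))
                      (concatUpTo-All _ (suc i) (λ k _ → aOnly (tri i + k)))
  ; lengths = triLengths lengths
  }
  where
  open AMember x
  length-triBlocks : ∀ i →
                     length (triBlocks seq i) ≡ length (concatUpTo (λ k → seq (tri i + k)) (suc i))
  length-triBlocks i = cong length (triBlocks-concatUpTo seq i)
  length-triBlocks-stable : ∀ {l} → (∀ i → length (seq i) ≡ l) →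
                            ∀ i → length (triBlocks seq i) ≡ suc i * l
  length-triBlocks-stable len≡l i =
    trans (length-triBlocks i) (length-concatUpTo _ (suc i) (λ _ → len≡l _))
  triLengths : StableOrGrowing seq → StableOrGrowing (triBlocks seq)
  triLengths (stable zero len≡0) = stable 0 λ i →
    trans (length-triBlocks-stable len≡0 i) (*-zeroʳ (suc i))
  triLengths (stable (suc l) len≡l) = growing λ i →
    ≤-trans (≤-trans (n≤1+n i) (m≤m*n (suc i) (suc l)))
            (≤-reflexive (≡-sym (length-triBlocks-stable len≡l i)))
  triLengths (growing i≤len) = growing λ i →
    ≤-trans (≤-trans (≤-trans (n≤tri i) (m≤m+n (tri i) i)) (i≤len (tri i + i)))
            (≤-trans (length-last≤length-concatUpTo _ i) (≤-reflexive (≡-sym (length-triBlocks i))))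

IsFinite : WSeq AB → Set
IsFinite w = Σ ℕ λ n → len w ≡ fin n

AllFinite : (WSeq AB → Set) → Set
AllFinite L = ∀ {w} → L w → IsFinite w

EventuallyAOnly : WSeq AB → Set
EventuallyAOnly w = Σ ℕ λ N → ∀ i → N ≤ i → i <ᴸ len w → AOnly (at w i)

-- eventual a-onliness needs excluded middle; it is only ever used to derive ⊥
FewB : (WSeq AB → Set) → Set
FewB L = ∀ {w} → L w → ¬ ¬ EventuallyAOnly w

IsFinite⇒EventuallyAOnly : ∀ {w} → IsFinite w → EventuallyAOnly w
IsFinite⇒EventuallyAOnly {⟨ _ , _ ⟩} (n , refl) = n , λ i n≤i i<n → ⊥-elim (≤⇒≯ n≤i i<n)

AllFinite⇒FewB : ∀ {L} → AllFinite L → FewB L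
AllFinite⇒FewB finite Lw = pure (IsFinite⇒EventuallyAOnly (finite Lw))

AllFinite-⊙ˡ : ∀ {e f} → AllFinite ⟦ e ⟧ → AllFinite ⟦ e ⊙ f ⟧
AllFinite-⊙ˡ finE (u , v , eu , _ , _ , |w|≡|u| , _) =
  let (n , |u|≡n) = finE eu in n , trans |w|≡|u| |u|≡n

AllFinite-⊙ʳ : ∀ {e f} → AllFinite ⟦ f ⟧ → AllFinite ⟦ e ⊙ f ⟧
AllFinite-⊙ʳ finF (u , v , _ , fv , |u|≡|v| , |w|≡|u| , _) =
  let (n , |v|≡n) = finF fv in n , trans |w|≡|u| (trans |u|≡|v| |v|≡n)

AllFinite-⊕ : ∀ {e f} → AllFinite ⟦ e ⟧ → AllFinite ⟦ f ⟧ → AllFinite ⟦ e ⊕ f ⟧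
AllFinite-⊕ finE finF (u , v , eu , fv , |w|≡max , _) with finE eu | finF fv
... | m , |u|≡m | n , |v|≡n = m ⊔ n , trans |w|≡max (cong₂ maxᴸ |u|≡m |v|≡n)

-- a strongly unbounded grouping of an infinite sequence would eventually overshoot |u|
AllFinite-ˢ : ∀ {L} → AllFinite L → AllFinite (Star StronglyUnboundedDiff L)
AllFinite-ˢ finL {⟨ fin n , _ ⟩} _ = n , refl
AllFinite-ˢ finL {⟨ ∞ , _ ⟩} (u , Lu , g , unbounded , _ , g≤|u| , _) with finL Lu
... | n , |u|≡n with unbounded (suc n)
... | N , jumps =
  ⊥-elim (≤⇒≯ (bound (suc N)) (≤-trans (jumps N ≤-refl) (m∸n≤m (g (suc N)) (g N))))
  where
  bound : ∀ i → g i ≤ n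
  bound i = subst (g i ≤ᴸ_) |u|≡n (g≤|u| i tt)

FewB-⊙ : ∀ {e f} → FewB ⟦ e ⟧ → FewB ⟦ f ⟧ → FewB ⟦ e ⊙ f ⟧
FewB-⊙ fewE fewF (u , v , eu , fv , |u|≡|v| , |w|≡|u| , entries) =
  fewE eu >>= λ (N₁ , uA) → fewF fv >>= λ (N₂ , vA) →
  pure (N₁ ⊔ N₂ , λ i N≤i i<w →
    let i<u = subst (i <ᴸ_) |w|≡|u| i<w in
    subst AOnly (≡-sym (entries i i<w))
      (++⁺ (uA i (≤-trans (m≤m⊔n N₁ N₂) N≤i) i<u)
           (vA i (≤-trans (m≤n⊔m N₁ N₂) N≤i) (subst (i <ᴸ_) |u|≡|v| i<u))))

FewB-⊕ : ∀ {e f} → FewB ⟦ e ⟧ → FewB ⟦ f ⟧ → FewB ⟦ e ⊕ f ⟧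
FewB-⊕ fewE fewF (u , v , eu , fv , _ , entries) =
  fewE eu >>= λ (N₁ , uA) → fewF fv >>= λ (N₂ , vA) →
  pure (N₁ ⊔ N₂ , λ i N≤i i<w → case entries i i<w of λ where
    (inj₁ (i<u , wi≡ui)) → subst AOnly (≡-sym wi≡ui) (uA i (≤-trans (m≤m⊔n N₁ N₂) N≤i) i<u)
    (inj₂ (i<v , wi≡vi)) → subst AOnly (≡-sym wi≡vi) (vA i (≤-trans (m≤n⊔m N₁ N₂) N≤i) i<v))

<-≤ᴸ-trans : ∀ {k q} l → k < q → q ≤ᴸ l → k <ᴸ l
<-≤ᴸ-trans (fin n) k<q q≤n = <-≤-trans k<q q≤n
<-≤ᴸ-trans ∞       _   _   = tt

-- either the grouping passes the point N beyond which u is a-only, or it stalls below N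
FewB-Star : ∀ {P L} → FewB L → FewB (Star P L)
FewB-Star fewL {⟨ fin n , _ ⟩} _ = pure (IsFinite⇒EventuallyAOnly (n , refl))
FewB-Star fewL {⟨ ∞ , ws ⟩} (u , Lu , g , _ , mono , g≤|u| , entries) =
  fewL Lu >>= λ (N , uA) → ¬¬-excluded-middle {A = Σ ℕ λ i → N ≤ g i} >>= λ where
    (yes (i₀ , N≤gi₀)) → pure (suc i₀ , λ where
      (suc i) (s≤s i₀≤i) _ → blockAOnly i λ k gi≤k _ k<|u| →
        uA k (≤-trans N≤gi₀ (≤-trans (NonDecreasing-≤ g-mono i₀≤i) gi≤k)) k<|u|)
    (no never-reaches) →
      NonDecreasing-bounded⇒EventuallyConstant N g g-mono
        (λ i → ≤-trans (<⇒≤ (≰⇒> (λ N≤gi → never-reaches (i , N≤gi)))) (m≤m+n N (g 0)))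
      >>= λ (M , const) → pure (suc M , λ where
        (suc i) (s≤s M≤i) _ → blockAOnly i λ k gi≤k k<gsi _ → ⊥-elim (≤⇒≯ gi≤k
          (subst (k <_) (trans (const (suc i) (m≤n⇒m≤1+n M≤i)) (≡-sym (const i M≤i))) k<gsi)))
  where
  g-mono : NonDecreasing g
  g-mono i = mono i tt
  blockAOnly : ∀ i → (∀ k → g i ≤ k → k < g (suc i) → k <ᴸ len u → AOnly (at u k)) →
               AOnly (ws (suc i))
  blockAOnly i all = subst AOnly (≡-sym (entries (suc i) tt))
    (block-All (at u) (g i) (g (suc i)) λ k gi≤k k<gsi →
      all k gi≤k k<gsi (<-≤ᴸ-trans (len u) k<gsi (g≤|u| (suc i) tt)))

data Kind (L : WSeq AB → Set) : Set where
  finite : AllFinite L → Kind L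
  aOnly  : AMember L → FewB L → Kind L
  withB  : BMember L → Kind L

Kind-⊙ : ∀ e f → Kind ⟦ e ⟧ → Kind ⟦ f ⟧ → Kind ⟦ e ⊙ f ⟧
Kind-⊙ e f (finite x)   _            = finite (AllFinite-⊙ˡ {e} {f} x)
Kind-⊙ e f (aOnly _ _)  (finite y)   = finite (AllFinite-⊙ʳ {e} {f} y)
Kind-⊙ e f (withB _)    (finite y)   = finite (AllFinite-⊙ʳ {e} {f} y)
Kind-⊙ e f (aOnly x fx) (aOnly y fy) = aOnly (AMember-⊙ {e} {f} x y) (FewB-⊙ {e} {f} fx fy)
Kind-⊙ e f (aOnly x _)  (withB y)    = withB (BMember-⊙ʳ {e} {f} (AMember⇒TameMember x) y)
Kind-⊙ e f (withB x)    (aOnly y _)  = withB (BMember-⊙ˡ {e} {f} x (AMember⇒TameMember y))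
Kind-⊙ e f (withB x)    (withB y)    = withB (BMember-⊙ˡ {e} {f} x (BMember.tameMember y))

Kind-⊕ : ∀ e f → Kind ⟦ e ⟧ → Kind ⟦ f ⟧ → Kind ⟦ e ⊕ f ⟧
Kind-⊕ e f (withB x)    _            = withB (BMember-map (⊕-∞ˡ e f) x)
Kind-⊕ e f (aOnly _ _)  (withB y)    = withB (BMember-map (⊕-∞ʳ e f) y)
Kind-⊕ e f (finite _)   (withB y)    = withB (BMember-map (⊕-∞ʳ e f) y)
Kind-⊕ e f (aOnly x fx) (aOnly _ fy) = aOnly (AMember-map (⊕-∞ˡ e f) x) (FewB-⊕ {e} {f} fx fy)
Kind-⊕ e f (aOnly x fx) (finite y)   =
  aOnly (AMember-map (⊕-∞ˡ e f) x) (FewB-⊕ {e} {f} fx (AllFinite⇒FewB {⟦ f ⟧} y))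
Kind-⊕ e f (finite x)   (aOnly y fy) =
  aOnly (AMember-map (⊕-∞ʳ e f) y) (FewB-⊕ {e} {f} (AllFinite⇒FewB {⟦ e ⟧} x) fy)
Kind-⊕ e f (finite x)   (finite y)   = finite (AllFinite-⊕ {e} {f} x y)

Kind-Star : ∀ {P L} → P ∞ suc → P ∞ (λ _ → 0) → L emptySeq → Kind L → Kind (Star P L)
Kind-Star {P} {L} p₁ p₀ L∅ (withB x)    = withB (BMember-map (Star-identity {P} p₁) x)
Kind-Star {P} {L} p₁ p₀ L∅ (aOnly x fx) =
  aOnly (AMember-map (Star-identity {P} p₁) x) (FewB-Star {P} fx)
Kind-Star {P} {L} p₁ p₀ L∅ (finite x)   = aOnly emptyEntries (FewB-Star {P} (AllFinite⇒FewB {L} x))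
  where
  emptyEntries : AMember (Star P L)
  emptyEntries = record
    { seq     = λ _ → []
    ; member  = Star-emptyEntries {P} p₀ L∅
    ; aOnly   = λ _ → []
    ; lengths = stable 0 (λ _ → refl)
    }

Kind-ˢ : ∀ {L} → Kind L → Kind (Star StronglyUnboundedDiff L)
Kind-ˢ (withB x)    = withB (BMember-triangular x)
Kind-ˢ (aOnly x fx) = aOnly (AMember-triangular x) (FewB-Star {StronglyUnboundedDiff} fx)
Kind-ˢ (finite x)   = finite (AllFinite-ˢ x)

Constant : List AB → WSeq AB → Set
Constant s w = ∀ i → i <ᴸ len w → at w i ≡ s

Kind-Constant : ∀ {s} → AOnly s → Kind (Constant s)
Kind-Constant {s} s-aOnly = aOnly
  (record { seq = λ _ → s ; member = λ _ _ → refl ; aOnly = λ _ → s-aOnly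
          ; lengths = stable (length s) (λ _ → refl) })
  (λ w≡s → pure (0 , λ i _ i<w → subst AOnly (≡-sym (w≡s i i<w)) s-aOnly))

classify : (f : BSExpr AB) → Kind ⟦ f ⟧
classify ∅       = finite λ |w|≡0 → 0 , |w|≡0
classify ε       = Kind-Constant []
classify ε̄       = finite λ (n , |w|≡n , _) → n , |w|≡n
classify (sym a) = Kind-Constant (refl ∷ [])
classify (sym b) = withB record
  { tameMember = record
    { seq    = λ _ → b ∷ []
    ; member = λ _ _ → refl
    ; bound  = 0
    ; tame   = λ _ _ r-ok → ((λ _ → SmallOrLarge-mono (m≤m+n _ 0) r-ok) , tt) , inj₁ z≤n
    }
  ; hasB = λ _ → here refl
  }
classify (e ⊙ f) = Kind-⊙ e f (classify e) (classify f)
classify (e ⊕ f) = Kind-⊕ e f (classify e) (classify f)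
classify (e ⋆)   = Kind-Star tt tt (emptySeq∈ e) (classify e)
classify (e ᴮ)   =
  Kind-Star (1 , λ i → ≤-reflexive (m+n∸n≡m 1 i)) (0 , λ _ → z≤n) (emptySeq∈ e) (classify e)
classify (e ˢ)   = Kind-ˢ (classify e)

-- Positions in ω-words

pos-step : ∀ (f : Seq) i → pos f i ≤ pos f (suc i)
pos-step f i = m≤m+n (pos f i) (length (f i))

pos-entry< : ∀ (f : Seq) i (q : Fin (length (f i))) → pos f i + toℕ q < pos f (suc i)
pos-entry< f i q = +-monoʳ-< (pos f i) (toℕ<n q)

InfinitelyOftenNonEmpty : Seq → Set
InfinitelyOftenNonEmpty f = ∀ N → ∃[ i ] (N ≤ i × ¬ (f i ≡ []))

pos-unbounded : ∀ {f} → InfinitelyOftenNonEmpty f → ∀ k → Σ ℕ λ i → k ≤ pos f i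
pos-unbounded {f} nonEmpty zero = 0 , z≤n
pos-unbounded {f} nonEmpty (suc k) with pos-unbounded nonEmpty k
... | i , k≤pos with nonEmpty i
... | j , i≤j , fj≢[] = suc j , ≤-trans (≤-reflexive (+-comm 1 k))
  (+-mono-≤ (≤-trans k≤pos (NonDecreasing-≤ (pos-step f) i≤j)) (non-empty (f j) fj≢[]))
  where
  non-empty : ∀ (s : List AB) → ¬ (s ≡ []) → 1 ≤ length s
  non-empty []      s≢[] = ⊥-elim (s≢[] refl)
  non-empty (_ ∷ _) _    = s≤s z≤n

EntryPosition : Seq → ℕ → Set
EntryPosition f k = Σ ℕ λ j → Σ (Fin (length (f j))) λ q → pos f j + toℕ q ≡ k

locate : ∀ (f : Seq) k i → k < pos f i → EntryPosition f k
locate f k (suc i) k<pos with k <? pos f i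
... | yes k<pos' = locate f k i k<pos'
... | no  k≮pos' =
  i , fromℕ< offset< , trans (cong (pos f i +_) (toℕ-fromℕ< offset<)) (m+[n∸m]≡n pos≤k)
  where
  pos≤k : pos f i ≤ k
  pos≤k = ≮⇒≥ k≮pos'
  offset< : k ∸ pos f i < length (f i)
  offset< = subst (k ∸ pos f i <_) (m+n∸m≡n (pos f i) (length (f i))) (∸-monoˡ-< k<pos pos≤k)

entryIndex≥ : ∀ (f : Seq) {N j} (q : Fin (length (f j))) → pos f N ≤ pos f j + toℕ q → N ≤ j
entryIndex≥ f {N} {j} q pos≤ = ≮⇒≥ λ j<N →
  ≤⇒≯ (≤-trans (NonDecreasing-≤ (pos-step f) j<N) pos≤) (pos-entry< f j q)

EntryPosition-unique : ∀ (f : Seq) {i j} (q : Fin (length (f i))) (r : Fin (length (f j))) →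
                       pos f i + toℕ q ≡ pos f j + toℕ r → i ≡ j
EntryPosition-unique f {i} {j} q r eq = ≤-antisym
  (entryIndex≥ f r (≤-trans (m≤m+n (pos f i) (toℕ q)) (≤-reflexive eq)))
  (entryIndex≥ f q (≤-trans (m≤m+n (pos f j) (toℕ r)) (≤-reflexive (≡-sym eq))))

entryPosition : ∀ {f} → InfinitelyOftenNonEmpty f → ∀ k → EntryPosition f k
entryPosition nonEmpty k = let (i , k<pos) = pos-unbounded nonEmpty (suc k) in locate _ k i k<pos

IsOmega-bEntries : ∀ {u y} → IsOmega u y → InfinitelyManyB y → ∀ N → ∃[ i ] (N ≤ i × b ∈ at u i)
IsOmega-bEntries {u} {y} ω@(_ , _ , entries) infB N with infB (pos (at u) N)
... | k , pos≤k , yk≡b with entryPosition (proj₁ (proj₂ ω)) k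
... | j , q , refl = j , entryIndex≥ (at u) q pos≤k ,
  subst (_∈ at u j) (trans (≡-sym (entries j q)) yk≡b) (∈-lookup q)

Kind⇒BMember : ∀ {L u y} → Kind L → L u → IsOmega u y → InfinitelyManyB y → BMember L
Kind⇒BMember (withB x) _ _ _ = x
Kind⇒BMember (finite allFinite) Lu (|u|≡∞ , _) _ with trans (≡-sym |u|≡∞) (proj₂ (allFinite Lu))
... | ()
Kind⇒BMember (aOnly _ fewB) Lu ω infB = ⊥-elim (fewB Lu λ (N , uA) →
  let (i , N≤i , b∈ui) = IsOmega-bEntries ω infB N in
  AOnly⇒b∉ (uA i N≤i (subst (i <ᴸ_) (≡-sym (proj₁ ω)) tt)) b∈ui)

ωConcat : (c : Seq) → InfinitelyOftenNonEmpty c → ℕ → AB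
ωConcat c nonEmpty k = lookup (c j) q
  where
  j : ℕ
  j = proj₁ (entryPosition nonEmpty k)
  q : Fin (length (c j))
  q = proj₁ (proj₂ (entryPosition nonEmpty k))

-- entries occupy disjoint intervals, so a position determines its entry and offset
ωConcat-IsOmega : ∀ c nonEmpty → IsOmega ⟨ ∞ , c ⟩ (ωConcat c nonEmpty)
ωConcat-IsOmega c nonEmpty = refl , nonEmpty , entries
  where
  entries : ∀ i (k : Fin (length (c i))) → ωConcat c nonEmpty (pos c i + toℕ k) ≡ lookup (c i) k
  entries i k with entryPosition nonEmpty (pos c i + toℕ k)
  ... | j , q , eq with EntryPosition-unique c q k eq
  ... | refl = cong (lookup (c i)) (toℕ-injective (+-cancelˡ-≡ (pos c i) (toℕ q) (toℕ k) eq))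

_++ω_ : List AB → (ℕ → AB) → ℕ → AB
([]      ++ω z) k       = z k
((x ∷ w) ++ω z) zero    = x
((x ∷ w) ++ω z) (suc k) = (w ++ω z) k

++ω-lookup : ∀ w z (q : Fin (length w)) → (w ++ω z) (toℕ q) ≡ lookup w q
++ω-lookup (x ∷ w) z Fin.zero    = refl
++ω-lookup (x ∷ w) z (Fin.suc q) = ++ω-lookup w z q

++ω-shift : ∀ w z k → (w ++ω z) (length w + k) ≡ z k
++ω-shift []      z k = refl
++ω-shift (x ∷ w) z k = ++ω-shift w z k

aRunAt : (ℕ → AB) → ℕ → ℕ
aRunAt y zero    = 0
aRunAt y (suc p) = step (aRunAt y p) (y p)

Agree : (ℕ → AB) → ℕ → List AB → Set
Agree y Q s = ∀ (q : Fin (length s)) → y (Q + toℕ q) ≡ lookup s q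

Agree-head : ∀ {y Q x s} → Agree y Q (x ∷ s) → y Q ≡ x
Agree-head {y} {Q} agree = trans (cong y (≡-sym (+-identityʳ Q))) (agree Fin.zero)

Agree-tail : ∀ {y Q x s} → Agree y Q (x ∷ s) → Agree y (suc Q) s
Agree-tail {y} {Q} agree q = trans (cong y (≡-sym (+-suc Q (toℕ q)))) (agree (Fin.suc q))

aRunAt-Agree : ∀ {y} Q s → Agree y Q s → aRunAt y (Q + length s) ≡ aRun (aRunAt y Q) s
aRunAt-Agree {y} Q [] _ = cong (aRunAt y) (+-identityʳ Q)
aRunAt-Agree {y} Q (x ∷ s) agree = begin
  aRunAt y (Q + suc (length s))     ≡⟨ cong (aRunAt y) (+-suc Q (length s)) ⟩
  aRunAt y (suc Q + length s)       ≡⟨ aRunAt-Agree (suc Q) s (Agree-tail {y} agree) ⟩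
  aRun (step (aRunAt y Q) (y Q)) s  ≡⟨ cong (λ z → aRun (step (aRunAt y Q) z) s) (Agree-head {y} agree) ⟩
  aRun (step (aRunAt y Q) x) s      ∎
  where open ≡-Reasoning

Tame-Agree : ∀ {y C m} Q s → Agree y Q s → Tame C m (aRunAt y Q) s → ∀ (q : Fin (length s)) →
             y (Q + toℕ q) ≡ b → SmallOrLarge C m (aRunAt y (Q + toℕ q))
Tame-Agree {y} Q (x ∷ s) agree (atB , _) Fin.zero yb =
  subst (SmallOrLarge _ _) (cong (aRunAt y) (≡-sym (+-identityʳ Q)))
        (atB (trans (≡-sym (Agree-head {y} agree)) (trans (cong y (≡-sym (+-identityʳ Q))) yb)))
Tame-Agree {y} {C} {m} Q (x ∷ s) agree (_ , tame) (Fin.suc q) yb =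
  subst (λ p → SmallOrLarge C m (aRunAt y p)) (≡-sym (+-suc Q (toℕ q)))
    (Tame-Agree (suc Q) s (Agree-tail {y} agree)
      (subst (λ z → Tame C m (step (aRunAt y Q) z) s) (≡-sym (Agree-head {y} agree)) tame)
      q (trans (cong y (≡-sym (+-suc Q (toℕ q)))) yb))

aⁿb : ℕ → List AB
aⁿb n = replicate n a ++ [ b ]

aⁿb-Agree : ∀ y Q n → (∀ j → j < n → y (Q + j) ≡ a) → y (Q + n) ≡ b → Agree y Q (aⁿb n)
aⁿb-Agree y Q zero    _  yb Fin.zero    = yb
aⁿb-Agree y Q (suc n) as _  Fin.zero    = as 0 (s≤s z≤n)
aⁿb-Agree y Q (suc n) as yb (Fin.suc q) =
  trans (cong y (+-suc Q (toℕ q)))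
    (aⁿb-Agree y (suc Q) n (λ j j<n → trans (cong y (≡-sym (+-suc Q j))) (as (suc j) (s≤s j<n)))
                           (trans (cong y (≡-sym (+-suc Q n))) yb) q)

aRunAt-as : ∀ y Q n → (∀ j → j < n → y (Q + j) ≡ a) → aRunAt y (Q + n) ≡ aRunAt y Q + n
aRunAt-as y Q zero _ = trans (cong (aRunAt y) (+-identityʳ Q)) (≡-sym (+-identityʳ _))
aRunAt-as y Q (suc n) as = begin
  aRunAt y (Q + suc n)                  ≡⟨ cong (aRunAt y) (+-suc Q n) ⟩
  step (aRunAt y (Q + n)) (y (Q + n))   ≡⟨ cong (step (aRunAt y (Q + n))) (as n ≤-refl) ⟩
  suc (aRunAt y (Q + n))                ≡⟨ cong suc (aRunAt-as y Q n (λ j → as j ∘ m<n⇒m<1+n)) ⟩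
  suc (aRunAt y Q + n)                  ≡⟨ ≡-sym (+-suc (aRunAt y Q) n) ⟩
  aRunAt y Q + suc n                    ∎
  where open ≡-Reasoning

FirstB : (ℕ → AB) → ℕ → Set
FirstB y Q = Σ ℕ λ n → (∀ j → j < n → y (Q + j) ≡ a) × y (Q + n) ≡ b

firstB-within : ∀ y d Q → y (Q + d) ≡ b → FirstB y Q
firstB-within y zero    Q yb = 0 , (λ _ ()) , yb
firstB-within y (suc d) Q yb with y Q in yQ
... | b = 0 , (λ _ ()) , trans (cong y (+-identityʳ Q)) yQ
... | a with firstB-within y d (suc Q) (trans (cong y (≡-sym (+-suc Q d))) yb)
...   | n , as , yb' = suc n , as' , trans (cong y (+-suc Q n)) yb'
  where
  as' : ∀ j → j < suc n → y (Q + j) ≡ a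
  as' zero    _         = trans (cong y (+-identityʳ Q)) yQ
  as' (suc j) (s≤s j<n) = trans (cong y (+-suc Q j)) (as j j<n)

-- y is cut into the blocks a^(gap k) b, the k-th of which starts at position start k
module Blocks (y : ℕ → AB) (infB : InfinitelyManyB y) where

  firstB : ∀ Q → FirstB y Q
  firstB Q with infB Q
  ... | k , Q≤k , yk≡b = firstB-within y (k ∸ Q) Q (trans (cong y (m+[n∸m]≡n Q≤k)) yk≡b)

  mutual
    start : ℕ → ℕ
    start zero    = 0
    start (suc k) = suc (start k + gap k)

    gap : ℕ → ℕ
    gap k = proj₁ (firstB (start k))

  gap-as : ∀ k j → j < gap k → y (start k + j) ≡ a
  gap-as k = proj₁ (proj₂ (firstB (start k)))

  gap-b : ∀ k → y (start k + gap k) ≡ b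
  gap-b k = proj₂ (proj₂ (firstB (start k)))

  pos-blocks : ∀ k → pos (aⁿb ∘ gap) k ≡ start k
  pos-blocks zero    = refl
  pos-blocks (suc k) = begin
    pos (aⁿb ∘ gap) k + length (aⁿb (gap k)) ≡⟨ cong₂ _+_ (pos-blocks k) (length-aⁿb (gap k)) ⟩
    start k + suc (gap k)                    ≡⟨ +-suc (start k) (gap k) ⟩
    suc (start k + gap k)                    ∎
    where
    open ≡-Reasoning
    length-aⁿb : ∀ n → length (aⁿb n) ≡ suc n
    length-aⁿb n =
      trans (length-++ (replicate n a)) (trans (cong (_+ 1) (length-replicate n)) (+-comm n 1))

  blocks-IsOmega : IsOmega ⟨ ∞ , aⁿb ∘ gap ⟩ y
  blocks-IsOmega = refl , (λ N → N , ≤-refl , aⁿb≢[] (gap N)) , λ i →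
    subst (λ Q → Agree y Q (aⁿb (gap i))) (≡-sym (pos-blocks i))
          (aⁿb-Agree y (start i) (gap i) (gap-as i) (gap-b i))
    where
    aⁿb≢[] : ∀ n → ¬ (aⁿb n ≡ [])
    aⁿb≢[] zero    ()
    aⁿb≢[] (suc n) ()

  aRunAt-gap : ∀ k → aRunAt y (start k + gap k) ≡ gap k
  aRunAt-gap k = trans (aRunAt-as y (start k) (gap k) (gap-as k)) (cong (_+ gap k) (aRunAt-start k))
    where
    aRunAt-start : ∀ k → aRunAt y (start k) ≡ 0
    aRunAt-start zero    = refl
    aRunAt-start (suc k) = cong (step (aRunAt y (start k + gap k))) (gap-b k)

  k≤start : ∀ k → k ≤ start k
  k≤start zero    = z≤n
  k≤start (suc k) = s≤s (≤-trans (k≤start k) (m≤m+n (start k) (gap k)))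

-- Membership in (a^B b + a^S b)^ω

EventuallySmallOrLarge : ℕ → (ℕ → ℕ) → Set
EventuallySmallOrLarge C n = ∀ M → Σ ℕ λ N → ∀ k → N ≤ k → SmallOrLarge C M (n k)

cumulative : (ℕ → ℕ) → ℕ → ℕ
cumulative d zero    = d 0
cumulative d (suc k) = cumulative d k + d (suc k)

cumulative-diff : ∀ d i → cumulative d (suc i) ∸ cumulative d i ≡ d (suc i)
cumulative-diff d i = m+n∸m≡n (cumulative d i) (d (suc i))

replicate-a∈Star : ∀ (P : Len → (ℕ → ℕ) → Set) d → P ∞ (cumulative d) →
                   Star P ⟦ sym a ⟧ ⟨ ∞ , (λ k → replicate (d k) a) ⟩
replicate-a∈Star P d p =
  ⟨ ∞ , (λ _ → [ a ]) ⟩ , (λ _ _ → refl) , cumulative d , p , (λ i _ → m≤m+n _ _) ,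
  (λ _ _ → tt) , entries
  where
  entries : ∀ k → ⊤ →
            replicate (d k) a ≡ block (λ _ → [ a ]) (prevg (cumulative d) k) (cumulative d k)
  entries zero    _ = ≡-sym (block-singleton a 0 (d 0))
  entries (suc k) _ = ≡-sym (trans (block-singleton a (cumulative d k) (cumulative d (suc k)))
                                   (cong (λ n → replicate n a) (cumulative-diff d k)))

-- gaps x ≤ C go to the a^B b side and the others to the a^S b side
boundedPart : ℕ → ℕ → ℕ
boundedPart C x with x ≤? C
... | yes _ = x
... | no  _ = 0

unboundedPart : ℕ → ℕ → ℕ → ℕ
unboundedPart C x k with x ≤? C
... | yes _ = k
... | no  _ = x

boundedPart≤ : ∀ C x → boundedPart C x ≤ C
boundedPart≤ C x with x ≤? C
... | yes x≤C = x≤C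
... | no  _   = z≤n

unboundedPart≥ : ∀ {C M} x k → M ≤ k → SmallOrLarge C M x → M ≤ unboundedPart C x k
unboundedPart≥ {C} x k M≤k x-ok with x ≤? C | x-ok
... | yes _   | _         = M≤k
... | no  x≰C | inj₁ x≤C  = ⊥-elim (x≰C x≤C)
... | no  _   | inj₂ M≤x  = M≤x

parts-cover : ∀ C x k → (x ≡ boundedPart C x) ⊎ (x ≡ unboundedPart C x k)
parts-cover C x k with x ≤? C
... | yes _ = inj₁ refl
... | no  _ = inj₂ refl

aⁿb-seq∈target : ∀ C n → EventuallySmallOrLarge C n →
  ⟦ ((sym a ᴮ) ⊙ sym b) ⊕ ((sym a ˢ) ⊙ sym b) ⟧ ⟨ ∞ , aⁿb ∘ n ⟩
aⁿb-seq∈target C n eventually =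
  ⟨ ∞ , aⁿb ∘ small ⟩ , ⟨ ∞ , (λ k → aⁿb (large k)) ⟩ ,
  ⊙-∞ (sym a ᴮ) (sym b) (replicate-a∈Star BoundedDiff small bounded) (λ _ _ → refl) ,
  ⊙-∞ (sym a ˢ) (sym b) (replicate-a∈Star StronglyUnboundedDiff large unbounded) (λ _ _ → refl) ,
  refl , λ k _ → case parts-cover C (n k) k of λ where
    (inj₁ n≡small) → inj₁ (tt , cong aⁿb n≡small)
    (inj₂ n≡large) → inj₂ (tt , cong aⁿb n≡large)
  where
  small : ℕ → ℕ
  small k = boundedPart C (n k)
  large : ℕ → ℕ
  large k = unboundedPart C (n k) k
  bounded : BoundedDiff ∞ (cumulative small)
  bounded = C , λ i → subst (_≤ C) (≡-sym (cumulative-diff small i)) (boundedPart≤ C (n (suc i)))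
  unbounded : StronglyUnboundedDiff ∞ (cumulative large)
  unbounded M = let (N , after) = eventually M in N ⊔ M , λ i N⊔M≤i →
    let N⊔M≤1+i = m≤n⇒m≤1+n N⊔M≤i in
    subst (M ≤_) (≡-sym (cumulative-diff large i))
      (unboundedPart≥ (n (suc i)) (suc i) (≤-trans (m≤n⊔m N M) N⊔M≤1+i)
                      (after (suc i) (≤-trans (m≤m⊔n N M) N⊔M≤1+i)))

InfinitelyManyB-drop : ∀ {x y} n → (∀ k → x (n + k) ≡ y k) →
                       InfinitelyManyB x → InfinitelyManyB y
InfinitelyManyB-drop {x} {y} n x≡y infB N with infB (n + N)
... | k , n+N≤k , xk≡b =
  k ∸ n , m+n≤o⇒m≤o∸n N (≤-trans (≤-reflexive (+-comm N n)) n+N≤k) ,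
  trans (≡-sym (x≡y (k ∸ n))) (trans (cong x (m+[n∸m]≡n (≤-trans (m≤m+n n N) n+N≤k))) xk≡b)

∈ω-component : ∀ (E : ωBSExpr AB) x → ⟦ E ⟧ω x →
  Σ (RE AB) λ e → Σ (BSExpr AB) λ f → ProdSem e f x × (∀ y → ProdSem e f y → ⟦ E ⟧ω y)
∈ω-component ((e , f) ∷ E) x (inj₁ x∈ef) = e , f , x∈ef , λ _ → inj₁
∈ω-component ((e , f) ∷ E) x (inj₂ x∈E) =
  let (e' , f' , x∈e'f' , sound) = ∈ω-component E x x∈E in e' , f' , x∈e'f' , λ y → inj₂ ∘ sound y

module Witness (w : List AB) {f : BSExpr AB} (B : BMember ⟦ f ⟧) where

  open BMember B

  nonEmpty : InfinitelyOftenNonEmpty seq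
  nonEmpty N = N , ≤-refl , λ seqN≡[] → case subst (b ∈_) seqN≡[] (hasB N) of λ ()

  y : ℕ → AB
  y = w ++ω ωConcat seq nonEmpty

  entryStart : ℕ → ℕ
  entryStart i = length w + pos seq i

  entry-Agree : ∀ i → Agree y (entryStart i) (seq i)
  entry-Agree i q = trans (cong y (+-assoc (length w) (pos seq i) (toℕ q)))
    (trans (++ω-shift w _ (pos seq i + toℕ q)) (proj₂ (proj₂ (ωConcat-IsOmega seq nonEmpty)) i q))

  y∈ProdSem : ∀ {e} → REsem e w → ProdSem e f y
  y∈ProdSem w∈e =
    w , w∈e , ωConcat seq nonEmpty , (⟨ ∞ , seq ⟩ , member , ωConcat-IsOmega seq nonEmpty) ,
    ++ω-lookup w _ , ++ω-shift w _

  infB : InfinitelyManyB y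
  infB N with pos-unbounded nonEmpty N
  ... | i , N≤pos =
    entryStart i + toℕ q , ≤-trans N≤pos (≤-trans (m≤n+m _ (length w)) (m≤m+n _ _)) ,
    trans (entry-Agree i q) (≡-sym (lookup-index (hasB i)))
    where
    q : Fin (length (seq i))
    q = index (hasB i)

  entry-tame : ∀ {M} i → M ≤ i → ∀ (q : Fin (length (seq (suc i)))) →
               y (entryStart (suc i) + toℕ q) ≡ b →
               SmallOrLarge (bound + bound) M (aRunAt y (entryStart (suc i) + toℕ q))
  entry-tame {M} i M≤i q yb =
    Tame-Agree (entryStart (suc i)) (seq (suc i)) (entry-Agree (suc i))
      (proj₁ (tame (suc i) (m≤n⇒m≤1+n M≤i) entry-begins-tame)) q yb
    where
    entry-begins-tame : SmallOrLarge bound M (aRunAt y (entryStart (suc i)))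
    entry-begins-tame = subst (SmallOrLarge bound M)
      (≡-sym (trans (cong (aRunAt y) (≡-sym (+-assoc (length w) (pos seq i) (length (seq i)))))
                    (aRunAt-Agree (entryStart i) (seq i) (entry-Agree i))))
      (TameWord-reset (hasB i) (tame i M≤i) _)

  runs-tame : ∀ M p → entryStart (suc M) ≤ p → y p ≡ b →
              SmallOrLarge (bound + bound) M (aRunAt y p)
  runs-tame M p start≤p yp≡b with entryPosition nonEmpty (p ∸ length w)
  ... | j , q , eq with entryIndex≥ seq q (subst (pos seq (suc M) ≤_) (≡-sym eq) pos≤)
    where
    pos≤ : pos seq (suc M) ≤ p ∸ length w
    pos≤ = m+n≤o⇒m≤o∸n (pos seq (suc M)) (≤-trans (≤-reflexive (+-comm _ (length w))) start≤p)
  ... | s≤s M≤i = subst (λ p → SmallOrLarge _ M (aRunAt y p)) at-p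
                         (entry-tame _ M≤i q (subst (λ p → y p ≡ b) (≡-sym at-p) yp≡b))
    where
    at-p : entryStart j + toℕ q ≡ p
    at-p = trans (+-assoc (length w) (pos seq j) (toℕ q))
             (trans (cong (length w +_) eq) (m+[n∸m]≡n (≤-trans (m≤m+n (length w) _) start≤p)))

  open Blocks y infB

  gaps : EventuallySmallOrLarge (bound + bound) gap
  gaps M = entryStart (suc M) , λ k start≤k →
    subst (SmallOrLarge _ M) (aRunAt-gap k)
      (runs-tame M (start k + gap k) (≤-trans start≤k (≤-trans (k≤start k) (m≤m+n _ _))) (gap-b k))

  y∈target : ⟦ target ⟧ω y
  y∈target = inj₁ ([] , refl , y , (⟨ ∞ , aⁿb ∘ gap ⟩ , aⁿb-seq∈target _ gap gaps , blocks-IsOmega) ,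
                   (λ ()) , (λ _ → refl))

lemma2p11 : (L : (ℕ → AB) → Set) → IsωBSRegular L →
    Σ (ℕ → AB) (λ x → L x × InfinitelyManyB x) →
    Σ (ℕ → AB) (λ y → L y × ⟦ target ⟧ω y)
lemma2p11 L (E , L⇔E) (x , Lx , infB) with ∈ω-component E x (proj₁ (L⇔E x) Lx)
... | e , f , (w , w∈e , y₀ , (u , fu , ω) , _ , x≡y₀) , component⇒E =
  y , proj₂ (L⇔E y) (component⇒E y (y∈ProdSem w∈e)) , y∈target
  where
  open Witness w {f} (Kind⇒BMember (classify f) fu ω (InfinitelyManyB-drop (length w) x≡y₀ infB))
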